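{- Let $k\geq 2$ and $n\geq 3k+3$ be integers, let $R=k(n-1)+1$, and let $t$ be an integer with $0\leq t\leq \left\lfloor \frac{kn-2k^{2}}{(k+1)^{2}}\right\rfloor$. Set \[ R'=\begin{cases}\binom{k}{2}+1 & \text{if } k \text{ is odd},\\ k(n-1)/2+1 & \text{if } k \text{ is even}.\end{cases} \] Let $H$ be a graph with $R+t$ vertices. If $e(H)\geq Rt+\binom{t}{2}+R'$, then $H$ contains $t+1$ pairwise disjoint vertex subsets $A_1,\dots,A_{t+1}$ such that for each $1\leq i\leq t+1$, $|A_i|=k+1$ and the induced subgraph $H[A_i]$ has minimum degree at least $1$.
   Context: All graphs are finite and simple; $e(H)$ denotes the number of edges of $H$ and $H[A]$ the subgraph induced by a vertex set $A$. (Note $R=k(n-1)+1$ equals the Ramsey number $r(K_{1,k},K_n)$.) -}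

module Defs where

open import Data.Nat using (ℕ; zero; suc; _+_; _*_; _∸_; _<ᵇ_)
open import Data.Nat.DivMod using (_/_; _%_)
open import Data.Nat.Combinatorics using (_C_)
open import Data.Bool using (Bool; true; false; if_then_else_; _∧_)
open import Data.Fin using (Fin; toℕ)
open import Data.List using (List; map; allFin)
open import Data.Nat.ListAction using (sum)
open import Relation.Binary.PropositionalEquality using (_≡_)

record Graph (N : ℕ) : Set where
  field
    adj     : Fin N → Fin N → Bool
    symm    : ∀ u v → adj u v ≡ adj v u
    irrefl  : ∀ v → adj v v ≡ false
open Graph public

edges : ∀ {N} → Graph N → ℕ
edges {N} H =
  sum (map (λ u → sum (map (λ v → if (toℕ u <ᵇ toℕ v) ∧ adj H u v then 1 else 0)
                           (allFin N)))
           (allFin N))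

R′ : ℕ → ℕ → ℕ
R′ k n with k % 2
... | 0 = (k * (n ∸ 1)) / 2 + 1
... | _ = k C 2 + 1

-- Write R = k(n − 1) + 1 and call a (k + 1)-set whose induced subgraph has no isolated vertex a
-- block. By induction on j ≤ t: if |S| ≤ R + j and e(H[S]) ≥ Rj + C(j,2) + R′, then S contains
-- j + 1 disjoint blocks. If some v ∈ S has degree at least (j + 1)(k + 1) + k in H[S], apply
-- induction to S − v, which loses at most R + j edges, and add the block formed by v and k of its
-- neighbours avoiding the j + 1 blocks found. Otherwise removing any block loses at most
-- (k + 1)((j + 1)(k + 1) + k − 1) ≤ R + j edges (this is where the bound on t is used), and a block
-- exists because e(H[S]) ≥ R′ > C(k,2), and e(H[S]) > |S|/2 when k is even.
--
-- A block is grown greedily as a set U with a map f sending each u ∈ U to a neighbour in U, by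
-- adding a vertex adjacent to U or an edge disjoint from U. When neither is possible every edge of
-- H[S] lies in U, so e(H[S]) ≤ C(|U|,2). An edge added at size k overshoots to k + 2; then a vertex
-- of U outside f(U) can be dropped, unless f is an involution of U. That is impossible for k odd,
-- since then |U| = k would be even; for k even the growth starts from a path on three vertices, on
-- which f is not injective, and non-injectivity persists.

module Submission where

open import Defs
open import Data.Bool using (Bool; true; false; _∧_; _∨_; not; if_then_else_) renaming (_≟_ to _≟ᵇ_)
open import Data.Bool.Properties
  using (T-≡; ∧-conicalˡ; ∧-conicalʳ; ∧-zeroʳ; ∧-identityʳ; ∧-comm; ∨-zeroʳ; ∨-identityʳ)
open import Data.Empty using (⊥-elim)
open import Data.Fin using (Fin; zero; suc; _≟_; toℕ; inject≤; fromℕ<; combine; remQuot)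
open import Data.Fin.Patterns using (0F; 1F)
open import Data.Fin.Properties as Fin using (inject≤-injective; remQuot-combine; any?)
open import Data.List using (map; allFin; tabulate)
open import Data.List.Properties using (map-tabulate)
open import Data.Nat using (ℕ; zero; suc; _+_; _*_; _∸_; _≤_; _<_; z≤n; s≤s; _<ᵇ_; _≤?_)
open import Data.Nat.Combinatorics using (_C_; nCk+nC[k+1]≡[n+1]C[k+1]; nC1≡n)
open import Data.Nat.DivMod using (_/_; _%_; m*n/n≡m; m/n*n≤m)
open import Data.Nat.Divisibility
  using (_∣_; _∣?_; _∣0; n∣n; ∣m∣n⇒∣m+n; divides-refl; ∣m⇒∣m*n; n∣m⇒m%n≡0; m%n≡0⇒n∣m)
open import Data.Nat.ListAction using (sum)
open import Data.Nat.Properties hiding (_≟_)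
open import Algebra.Properties.CommutativeMonoid.Sum +-0-commutativeMonoid
  using (sum-syntax; sum-cong-≗; ∑-distrib-+; ∑-comm; sum-replicate-zero)
open import Algebra.Properties.CommutativeSemigroup +-commutativeSemigroup
  using (x∙yz≈y∙xz; xy∙z≈x∙zy; xy∙z≈xz∙y)
open import Data.Nat.Tactic.RingSolver using (solve-∀)
open import Data.Product using (Σ; _×_; _,_; ∃; ∃₂; ∃-syntax; proj₁; proj₂; uncurry)
open import Data.Sum using (_⊎_; inj₁; inj₂)
open import Data.Vec.Functional using (_∷_; updateAt)
open import Data.Vec.Functional.Properties using (updateAt-updates; updateAt-minimal)
open import Function using (_∘_; const; Injective; Equivalence)
open import Relation.Binary.PropositionalEquality
open import Relation.Nullary using (does; yes; no; ¬_; contradiction)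
open import Relation.Nullary.Decidable using (dec-true; dec-false; _×-dec_)

private variable
  M N : ℕ

∑-mono-≤ : {f g : Fin N → ℕ} → (∀ i → f i ≤ g i) → ∑[ i < N ] f i ≤ ∑[ i < N ] g i
∑-mono-≤ {zero}  f≤g = z≤n
∑-mono-≤ {suc N} f≤g = +-mono-≤ (f≤g zero) (∑-mono-≤ (f≤g ∘ suc))

∑-extract : ∀ (v : Fin N) {f g : Fin N → ℕ} → g v ≡ 0 → (∀ i → i ≢ v → f i ≡ g i) →
            ∑[ i < N ] f i ≡ f v + ∑[ i < N ] g i
∑-extract {suc N} zero {f} {g} g0 f≗g = cong (f zero +_) (begin
  ∑[ i < N ] f (suc i)           ≡⟨ sum-cong-≗ (λ i → f≗g (suc i) (λ ())) ⟩
  ∑[ i < N ] g (suc i)           ≡⟨ cong (_+ ∑[ i < N ] g (suc i)) g0 ⟨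
  g zero + ∑[ i < N ] g (suc i)  ∎)
  where open ≡-Reasoning
∑-extract {suc N} (suc v) {f} {g} gv f≗g = begin
  f zero + ∑[ i < N ] f (suc i)
    ≡⟨ cong (f zero +_) (∑-extract v gv (λ i i≢v → f≗g (suc i) (i≢v ∘ Fin.suc-injective))) ⟩
  f zero + (f (suc v) + ∑g)      ≡⟨ x∙yz≈y∙xz (f zero) (f (suc v)) ∑g ⟩
  f (suc v) + (f zero + ∑g)      ≡⟨ cong (λ x → f (suc v) + (x + ∑g)) (f≗g zero (λ ())) ⟩
  f (suc v) + (g zero + ∑g)      ∎
  where
  open ≡-Reasoning
  ∑g = ∑[ i < N ] g (suc i)

sum-tabulate : ∀ {N} (f : Fin N → ℕ) → sum (tabulate f) ≡ ∑[ i < N ] f i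
sum-tabulate {zero}  f = refl
sum-tabulate {suc N} f = cong (f zero +_) (sum-tabulate (f ∘ suc))

sum-map-allFin : ∀ {N} (f : Fin N → ℕ) → sum (map f (allFin N)) ≡ ∑[ i < N ] f i
sum-map-allFin {N} f = trans (cong sum (map-tabulate (λ i → i) f)) (sum-tabulate f)

-- Subsets of Fin N, as Boolean functions rather than Data.Fin.Subset's vectors so that
-- each adj H v is one

Subset : ℕ → Set
Subset N = Fin N → Bool

infix  4 _∈_ _∉_ _⊆_
infixr 7 _∩_
infixl 6 _∪_
infixl 5 _─_ _-_

_∈_ _∉_ : Fin N → Subset N → Set
i ∈ P = P i ≡ true
i ∉ P = P i ≡ false

_⊆_ : Subset N → Subset N → Set
P ⊆ Q = ∀ {i} → i ∈ P → i ∈ Q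

∅ ⊤ : Subset N
∅ _ = false
⊤ _ = true

⁅_⁆ : Fin N → Subset N
⁅ v ⁆ i = does (i ≟ v)

_∪_ _∩_ _─_ : Subset N → Subset N → Subset N
(P ∪ Q) i = P i ∨ Q i
(P ∩ Q) i = P i ∧ Q i
(P ─ Q) i = P i ∧ not (Q i)

_-_ : Subset N → Fin N → Subset N
P - v = P ─ ⁅ v ⁆

private variable
  P Q : Subset N
  i v : Fin N

Nonempty : Subset N → Set
Nonempty P = ∃ (_∈ P)

x∈⁅x⁆ : (v : Fin N) → v ∈ ⁅ v ⁆
x∈⁅x⁆ v = dec-true (v ≟ v) refl

x∈⁅y⁆⇒x≡y : i ∈ ⁅ v ⁆ → i ≡ v
x∈⁅y⁆⇒x≡y {i = i} {v} i∈ with i ≟ v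
... | yes i≡v = i≡v

x≢y⇒x∉⁅y⁆ : i ≢ v → i ∉ ⁅ v ⁆
x≢y⇒x∉⁅y⁆ {i = i} {v} = dec-false (i ≟ v)

∈-or-∉ : ∀ (P : Subset N) i → i ∈ P ⊎ i ∉ P
∈-or-∉ P i with P i
... | true  = inj₁ refl
... | false = inj₂ refl

∈∧∉⇒≢ : ∀ {N} (P : Subset N) {i j} → i ∈ P → j ∉ P → i ≢ j
∈∧∉⇒≢ P i∈P i∉P refl with () ← trans (sym i∈P) i∉P

x∈p∪q⁻ : (P Q : Subset N) → i ∈ P ∪ Q → i ∈ P ⊎ i ∈ Q
x∈p∪q⁻ {i = i} P Q i∈ with P i
... | true  = inj₁ refl
... | false = inj₂ i∈

p⊆p∪q : (P Q : Subset N) → P ⊆ P ∪ Q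
p⊆p∪q P Q i∈P rewrite i∈P = refl

q⊆p∪q : (P Q : Subset N) → Q ⊆ P ∪ Q
q⊆p∪q P Q {i} i∈Q rewrite i∈Q = ∨-zeroʳ (P i)

x∈p∪⁅y⁆⁻ : ∀ (P : Subset N) → i ∈ P ∪ ⁅ v ⁆ → i ∈ P ⊎ i ≡ v
x∈p∪⁅y⁆⁻ {v = v} P i∈ with x∈p∪q⁻ P ⁅ v ⁆ i∈
... | inj₁ i∈P = inj₁ i∈P
... | inj₂ i∈v = inj₂ (x∈⁅y⁆⇒x≡y i∈v)

x∈p∪⁅x⁆ : ∀ (P : Subset N) (v : Fin N) → v ∈ P ∪ ⁅ v ⁆
x∈p∪⁅x⁆ P v = q⊆p∪q P ⁅ v ⁆ {v} (x∈⁅x⁆ v)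

x∈p∪⁅y⁆∪⁅z⁆⁻ : ∀ (P : Subset N) {x y} → i ∈ P ∪ ⁅ x ⁆ ∪ ⁅ y ⁆ → i ∈ P ⊎ i ≡ x ⊎ i ≡ y
x∈p∪⁅y⁆∪⁅z⁆⁻ P {x} i∈ with x∈p∪⁅y⁆⁻ (P ∪ ⁅ x ⁆) i∈
... | inj₂ i≡y = inj₂ (inj₂ i≡y)
... | inj₁ i∈P∪x with x∈p∪⁅y⁆⁻ P i∈P∪x
...   | inj₁ i∈P = inj₁ i∈P
...   | inj₂ i≡x = inj₂ (inj₁ i≡x)

p⊆p∪⁅x⁆∪⁅y⁆ : ∀ (P : Subset N) x y → P ⊆ P ∪ ⁅ x ⁆ ∪ ⁅ y ⁆
p⊆p∪⁅x⁆∪⁅y⁆ P x y = p⊆p∪q (P ∪ ⁅ x ⁆) ⁅ y ⁆ ∘ p⊆p∪q P ⁅ x ⁆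

x∈p∪⁅x⁆∪⁅y⁆ : ∀ (P : Subset N) x y → x ∈ P ∪ ⁅ x ⁆ ∪ ⁅ y ⁆
x∈p∪⁅x⁆∪⁅y⁆ P x y = p⊆p∪q (P ∪ ⁅ x ⁆) ⁅ y ⁆ (x∈p∪⁅x⁆ P x)

y∈p∪⁅x⁆∪⁅y⁆ : ∀ (P : Subset N) x y → y ∈ P ∪ ⁅ x ⁆ ∪ ⁅ y ⁆
y∈p∪⁅x⁆∪⁅y⁆ P x y = x∈p∪⁅x⁆ (P ∪ ⁅ x ⁆) y

x∈p∩q⁺ : (P Q : Subset N) → i ∈ P → i ∈ Q → i ∈ P ∩ Q
x∈p∩q⁺ P Q i∈P i∈Q rewrite i∈P = i∈Q

x∈p∩q⁻ : (P Q : Subset N) → i ∈ P ∩ Q → i ∈ P × i ∈ Q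
x∈p∩q⁻ {i = i} P Q i∈ = ∧-conicalˡ (P i) (Q i) i∈ , ∧-conicalʳ (P i) (Q i) i∈

x∈p∧x∉q⇒x∈p─q : (P Q : Subset N) → i ∈ P → i ∉ Q → i ∈ P ─ Q
x∈p∧x∉q⇒x∈p─q P Q i∈P i∉Q rewrite i∈P | i∉Q = refl

x∈p─q⁻ : (P Q : Subset N) → i ∈ P ─ Q → i ∈ P × i ∉ Q
x∈p─q⁻ {i = i} P Q i∈ with P i | Q i | i∈
... | true  | false | _ = refl , refl
... | true  | true  | ()
... | false | _     | ()

x∉p⇒x∉p─q : ∀ (P Q : Subset N) → i ∉ P → i ∉ P ─ Q
x∉p⇒x∉p─q P Q i∉P rewrite i∉P = refl

x∈q⇒x∉p─q : ∀ (P Q : Subset N) → i ∈ Q → i ∉ P ─ Q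
x∈q⇒x∉p─q {i = i} P Q i∈Q rewrite i∈Q = ∧-zeroʳ (P i)

p⊆q∧x∉q⇒x∉p : ∀ (P Q : Subset N) → P ⊆ Q → i ∉ Q → i ∉ P
p⊆q∧x∉q⇒x∉p {i = i} P Q P⊆Q i∉Q with ∈-or-∉ P i
... | inj₂ i∉P = i∉P
... | inj₁ i∈P with () ← trans (sym (P⊆Q i∈P)) i∉Q

x∈p∧x≢y⇒x∈p-y : (P : Subset N) → i ∈ P → i ≢ v → i ∈ P - v
x∈p∧x≢y⇒x∈p-y {v = v} P i∈P i≢v = x∈p∧x∉q⇒x∈p─q P ⁅ v ⁆ i∈P (x≢y⇒x∉⁅y⁆ i≢v)

x∈p-y⁻ : (P : Subset N) → i ∈ P - v → i ∈ P × i ≢ v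
x∈p-y⁻ {i = i} {v = v} P i∈ with P i | i ≟ v | i∈
... | true  | no i≢v | _  = refl , i≢v
... | true  | yes _  | ()
... | false | _      | ()

𝟙 : Bool → ℕ
𝟙 b = if b then 1 else 0

∣_∣ : Subset N → ℕ
∣_∣ {N} P = ∑[ i < N ] 𝟙 (P i)

∣∣-cong : (∀ i → P i ≡ Q i) → ∣ P ∣ ≡ ∣ Q ∣
∣∣-cong P≗Q = sum-cong-≗ (cong 𝟙 ∘ P≗Q)

p⊆q⇒∣p∣≤∣q∣ : (P Q : Subset N) → P ⊆ Q → ∣ P ∣ ≤ ∣ Q ∣
p⊆q⇒∣p∣≤∣q∣ P Q P⊆Q = ∑-mono-≤ 𝟙-mono
  where
  𝟙-mono : ∀ i → 𝟙 (P i) ≤ 𝟙 (Q i)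
  𝟙-mono i with P i in i∈P
  ... | false = z≤n
  ... | true  rewrite P⊆Q i∈P = ≤-refl

∣∅∣≡0 : ∀ N → ∣ ∅ {N} ∣ ≡ 0
∣∅∣≡0 N = sum-replicate-zero N

∣⊤∣≡n : ∀ N → ∣ ⊤ {N} ∣ ≡ N
∣⊤∣≡n zero    = refl
∣⊤∣≡n (suc N) = cong suc (∣⊤∣≡n N)

∑[𝟙*c]≡∣p∣*c : ∀ (P : Subset N) c → ∑[ i < N ] (𝟙 (P i) * c) ≡ ∣ P ∣ * c
∑[𝟙*c]≡∣p∣*c {zero}  P c = refl
∑[𝟙*c]≡∣p∣*c {suc N} P c =
  trans (cong (𝟙 (P zero) * c +_) (∑[𝟙*c]≡∣p∣*c (P ∘ suc) c)) (sym (*-distribʳ-+ c (𝟙 (P zero)) _))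

∣p∣≡𝟙+∣p-x∣ : ∀ (P : Subset N) v → ∣ P ∣ ≡ 𝟙 (P v) + ∣ P - v ∣
∣p∣≡𝟙+∣p-x∣ P v = ∑-extract v (cong 𝟙 v∉P-v) (λ i i≢v → cong 𝟙 (P≗P-v i i≢v))
  where
  v∉P-v : v ∉ P - v
  v∉P-v rewrite x∈⁅x⁆ v = ∧-zeroʳ (P v)
  P≗P-v : ∀ i → i ≢ v → P i ≡ (P - v) i
  P≗P-v i i≢v rewrite x≢y⇒x∉⁅y⁆ i≢v = sym (∧-identityʳ (P i))

x∈p⇒∣p∣≡1+∣p-x∣ : ∀ (P : Subset N) → v ∈ P → ∣ P ∣ ≡ suc ∣ P - v ∣
x∈p⇒∣p∣≡1+∣p-x∣ {v = v} P v∈P = trans (∣p∣≡𝟙+∣p-x∣ P v) (cong (λ b → 𝟙 b + ∣ P - v ∣) v∈P)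

x∉p⇒∣p∪⁅x⁆∣≡1+∣p∣ : ∀ (P : Subset N) → v ∉ P → ∣ P ∪ ⁅ v ⁆ ∣ ≡ suc ∣ P ∣
x∉p⇒∣p∪⁅x⁆∣≡1+∣p∣ {v = v} P v∉P =
  trans (x∈p⇒∣p∣≡1+∣p-x∣ (P ∪ ⁅ v ⁆) (q⊆p∪q P ⁅ v ⁆ (x∈⁅x⁆ v))) (cong suc (∣∣-cong removal))
  where
  removal : ∀ i → ((P ∪ ⁅ v ⁆) - v) i ≡ P i
  removal i with i ≟ v
  ... | yes refl rewrite v∉P = refl
  ... | no  _    = trans (∧-identityʳ _) (∨-identityʳ (P i))

x∉p∧y∉p⇒∣p∪⁅x⁆∪⁅y⁆∣≡2+∣p∣ : ∀ (P : Subset N) {x y} → x ∉ P → y ∉ P → x ≢ y →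
                             ∣ P ∪ ⁅ x ⁆ ∪ ⁅ y ⁆ ∣ ≡ 2 + ∣ P ∣
x∉p∧y∉p⇒∣p∪⁅x⁆∪⁅y⁆∣≡2+∣p∣ P {x} {y} x∉P y∉P x≢y =
  trans (x∉p⇒∣p∪⁅x⁆∣≡1+∣p∣ (P ∪ ⁅ x ⁆) y∉P∪x) (cong suc (x∉p⇒∣p∪⁅x⁆∣≡1+∣p∣ P x∉P))
  where
  y∉P∪x : y ∉ P ∪ ⁅ x ⁆
  y∉P∪x rewrite y∉P = x≢y⇒x∉⁅y⁆ (x≢y ∘ sym)

p⊆q-x⇒∣p∣<∣q∣ : ∀ (P Q : Subset N) → v ∈ Q → P ⊆ Q - v → ∣ P ∣ < ∣ Q ∣
p⊆q-x⇒∣p∣<∣q∣ {v = v} P Q v∈Q P⊆Q-v =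
  ≤-trans (s≤s (p⊆q⇒∣p∣≤∣q∣ P (Q - v) P⊆Q-v)) (≤-reflexive (sym (x∈p⇒∣p∣≡1+∣p-x∣ Q v∈Q)))

∣⁅x⁆∣≡1 : ∀ (v : Fin N) → ∣ ⁅ v ⁆ ∣ ≡ 1
∣⁅x⁆∣≡1 {N} v = begin
  ∣ ⁅ v ⁆ ∣              ≡⟨ x∈p⇒∣p∣≡1+∣p-x∣ ⁅ v ⁆ (x∈⁅x⁆ v) ⟩
  suc ∣ ⁅ v ⁆ - v ∣      ≡⟨ cong suc (∣∣-cong ⁅v⁆-v≗∅) ⟩
  suc ∣ ∅ {N} ∣          ≡⟨ cong suc (∣∅∣≡0 N) ⟩
  1                      ∎
  where
  open ≡-Reasoning
  ⁅v⁆-v≗∅ : ∀ i → (⁅ v ⁆ - v) i ≡ false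
  ⁅v⁆-v≗∅ i with i ≟ v
  ... | yes _ = refl
  ... | no  _ = refl

∣p∪q∣≤∣p∣+∣q∣ : ∀ (P Q : Subset N) → ∣ P ∪ Q ∣ ≤ ∣ P ∣ + ∣ Q ∣
∣p∪q∣≤∣p∣+∣q∣ {N} P Q = begin
  ∣ P ∪ Q ∣                                ≤⟨ ∑-mono-≤ 𝟙-∨ ⟩
  ∑[ i < N ] (𝟙 (P i) + 𝟙 (Q i))           ≡⟨ ∑-distrib-+ (𝟙 ∘ P) (𝟙 ∘ Q) ⟩
  ∣ P ∣ + ∣ Q ∣                            ∎
  where
  open ≤-Reasoning
  𝟙-∨ : ∀ i → 𝟙 (P i ∨ Q i) ≤ 𝟙 (P i) + 𝟙 (Q i)
  𝟙-∨ i with P i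
  ... | true  = s≤s z≤n
  ... | false = ≤-refl

∣p∣≤∣p─q∣+∣q∣ : ∀ (P Q : Subset N) → ∣ P ∣ ≤ ∣ P ─ Q ∣ + ∣ Q ∣
∣p∣≤∣p─q∣+∣q∣ {N} P Q = begin
  ∣ P ∣                                    ≤⟨ ∑-mono-≤ 𝟙-split ⟩
  ∑[ i < N ] (𝟙 ((P ─ Q) i) + 𝟙 (Q i))     ≡⟨ ∑-distrib-+ (𝟙 ∘ (P ─ Q)) (𝟙 ∘ Q) ⟩
  ∣ P ─ Q ∣ + ∣ Q ∣                        ∎
  where
  open ≤-Reasoning
  𝟙-split : ∀ i → 𝟙 (P i) ≤ 𝟙 ((P ─ Q) i) + 𝟙 (Q i)
  𝟙-split i with P i | Q i
  ... | true  | true  = s≤s z≤n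
  ... | true  | false = s≤s z≤n
  ... | false | _     = z≤n

0<∣p∣⇒Nonempty : ∀ (P : Subset N) → 0 < ∣ P ∣ → Nonempty P
0<∣p∣⇒Nonempty {suc N} P 0<∣P∣ with P zero in 0∈P
... | true  = zero , 0∈P
... | false with 0<∣p∣⇒Nonempty (P ∘ suc) 0<∣P∣
...   | i , i∈P = suc i , i∈P

enum : (P : Subset N) → Fin ∣ P ∣ → Fin N
enum {suc N} P i with P zero
enum {suc N} P zero    | true  = zero
enum {suc N} P (suc i) | true  = suc (enum (P ∘ suc) i)
enum {suc N} P i       | false = suc (enum (P ∘ suc) i)

enum-∈ : (P : Subset N) (i : Fin ∣ P ∣) → enum P i ∈ P
enum-∈ {suc N} P i with P zero in 0∈P
enum-∈ {suc N} P zero    | true  = 0∈P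
enum-∈ {suc N} P (suc i) | true  = enum-∈ (P ∘ suc) i
enum-∈ {suc N} P i       | false = enum-∈ (P ∘ suc) i

enum-injective : (P : Subset N) → Injective _≡_ _≡_ (enum P)
enum-injective {suc N} P {i} {j} eq with P zero
enum-injective {suc N} P {zero}  {zero}  eq | true = refl
enum-injective {suc N} P {suc i} {suc j} eq | true =
  cong suc (enum-injective (P ∘ suc) (Fin.suc-injective eq))
enum-injective {suc N} P {i}     {j}     eq | false =
  enum-injective (P ∘ suc) (Fin.suc-injective eq)

enum-surjective : (P : Subset N) → i ∈ P → ∃[ j ] enum P j ≡ i
enum-surjective {suc N} {i} P i∈P with P zero in 0∈P
enum-surjective {suc N} {zero}  P i∈P | true  = zero , refl
enum-surjective {suc N} {suc i} P i∈P | true  with enum-surjective (P ∘ suc) i∈P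
... | j , eq = suc j , cong suc eq
enum-surjective {suc N} {zero}  P i∈P | false with () ← trans (sym 0∈P) i∈P
enum-surjective {suc N} {suc i} P i∈P | false with enum-surjective (P ∘ suc) i∈P
... | j , eq = j , cong suc eq

choose : ∀ {m} (P : Subset N) → m ≤ ∣ P ∣ →
         Σ (Fin m → Fin N) λ g → Injective _≡_ _≡_ g × (∀ a → g a ∈ P)
choose P m≤∣P∣ =
  (λ a → enum P (inject≤ a m≤∣P∣)) ,
  (λ eq → inject≤-injective m≤∣P∣ m≤∣P∣ _ _ (enum-injective P eq)) ,
  (λ a → enum-∈ P (inject≤ a m≤∣P∣))

image : Subset M → (Fin M → Fin N) → Subset N
image {zero}  U f = ∅
image {suc M} U f = (if U zero then ⁅ f zero ⁆ else ∅) ∪ image (U ∘ suc) (f ∘ suc)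

x∈p⇒f[x]∈image : ∀ (U : Subset M) (f : Fin M → Fin N) {u} → u ∈ U → f u ∈ image U f
x∈p⇒f[x]∈image U f {zero} 0∈U rewrite 0∈U =
  p⊆p∪q ⁅ f zero ⁆ (image (U ∘ suc) (f ∘ suc)) {f zero} (x∈⁅x⁆ (f zero))
x∈p⇒f[x]∈image U f {suc u} u∈U =
  q⊆p∪q (if U zero then ⁅ f zero ⁆ else ∅) (image (U ∘ suc) (f ∘ suc)) {f (suc u)}
    (x∈p⇒f[x]∈image (U ∘ suc) (f ∘ suc) u∈U)

image⁻ : ∀ (U : Subset M) (f : Fin M → Fin N) {z} → z ∈ image U f → ∃[ u ] u ∈ U × f u ≡ z
image⁻ {suc M} U f {z} z∈ with x∈p∪q⁻ (if U zero then ⁅ f zero ⁆ else ∅) (image (U ∘ suc) (f ∘ suc)) z∈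
... | inj₂ z∈rest with image⁻ (U ∘ suc) (f ∘ suc) z∈rest
...   | u , u∈U , fu≡z = suc u , u∈U , fu≡z
image⁻ {suc M} U f {z} z∈ | inj₁ z∈first with U zero in 0∈U
...   | true = zero , 0∈U , sym (x∈⁅y⁆⇒x≡y z∈first)

∣image∣≤∣p∣ : ∀ (U : Subset M) (f : Fin M → Fin N) → ∣ image U f ∣ ≤ ∣ U ∣
∣image∣≤∣p∣ {zero}  {N} U f = ≤-reflexive (∣∅∣≡0 N)
∣image∣≤∣p∣ {suc M} {N} U f = begin
  ∣ image U f ∣                                          ≤⟨ ∣p∪q∣≤∣p∣+∣q∣ first (image (U ∘ suc) (f ∘ suc)) ⟩
  ∣ first ∣ + ∣ image (U ∘ suc) (f ∘ suc) ∣              ≤⟨ +-mono-≤ ∣first∣≤ (∣image∣≤∣p∣ (U ∘ suc) (f ∘ suc)) ⟩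
  𝟙 (U zero) + ∣ U ∘ suc ∣                               ∎
  where
  open ≤-Reasoning
  first = if U zero then ⁅ f zero ⁆ else ∅
  ∣first∣≤ : ∣ first ∣ ≤ 𝟙 (U zero)
  ∣first∣≤ with U zero
  ... | true  = ≤-reflexive (∣⁅x⁆∣≡1 (f zero))
  ... | false = ≤-reflexive (∣∅∣≡0 N)

pigeonhole : ∀ (U : Subset N) (f : Fin N → Fin N) {u₁ u₂} → u₁ ∈ U → u₂ ∈ U → u₁ ≢ u₂ → f u₁ ≡ f u₂ →
             ∃[ ρ ] ρ ∈ U ─ image U f
pigeonhole U f {u₁} {u₂} u₁∈U u₂∈U u₁≢u₂ fu₁≡fu₂ =
  0<∣p∣⇒Nonempty (U ─ image U f) (+-cancelʳ-< ∣ image U f ∣ 0 _ (begin-strict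
  0 + ∣ image U f ∣              ≤⟨ p⊆q⇒∣p∣≤∣q∣ (image U f) (image (U - u₁) f) image⊆ ⟩
  ∣ image (U - u₁) f ∣           ≤⟨ ∣image∣≤∣p∣ (U - u₁) f ⟩
  ∣ U - u₁ ∣                     <⟨ p⊆q-x⇒∣p∣<∣q∣ (U - u₁) U u₁∈U (λ u∈ → u∈) ⟩
  ∣ U ∣                          ≤⟨ ∣p∣≤∣p─q∣+∣q∣ U (image U f) ⟩
  ∣ U ─ image U f ∣ + ∣ image U f ∣ ∎))
  where
  open ≤-Reasoning
  image⊆ : image U f ⊆ image (U - u₁) f
  image⊆ z∈ with image⁻ U f z∈
  ... | u , u∈U , refl with u ≟ u₁
  ...   | yes refl = subst (_∈ image (U - u₁) f) (sym fu₁≡fu₂)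
                       (x∈p⇒f[x]∈image (U - u₁) f (x∈p∧x≢y⇒x∈p-y U u₂∈U (u₁≢u₂ ∘ sym)))
  ...   | no u≢u₁  = x∈p⇒f[x]∈image (U - u₁) f (x∈p∧x≢y⇒x∈p-y U u∈U u≢u₁)

-- Degrees

module _ {N : ℕ} (H : Graph N) where

  deg : Subset N → Fin N → ℕ
  deg S v = ∣ S ∩ adj H v ∣

  -- 2 e(H[S])
  degreeSum : Subset N → ℕ
  degreeSum S = ∑[ u < N ] (𝟙 (S u) * deg S u)

  deg-cong : ∀ {S T} → (∀ u → S u ≡ T u) → ∀ v → deg S v ≡ deg T v
  deg-cong S≗T v = ∣∣-cong (λ u → cong (_∧ adj H v u) (S≗T u))

  degreeSum-cong : ∀ {S T} → (∀ u → S u ≡ T u) → degreeSum S ≡ degreeSum T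
  degreeSum-cong S≗T = sum-cong-≗ (λ u → cong₂ _*_ (cong 𝟙 (S≗T u)) (deg-cong S≗T u))

  deg-mono : ∀ {S T} → S ⊆ T → ∀ v → deg S v ≤ deg T v
  deg-mono {S} {T} S⊆T v = p⊆q⇒∣p∣≤∣q∣ (S ∩ adj H v) (T ∩ adj H v) (λ {u} u∈ →
    let u∈S , vu = x∈p∩q⁻ S (adj H v) u∈ in x∈p∩q⁺ T (adj H v) (S⊆T u∈S) vu)

  adj⇒≢ : ∀ {u v} → adj H u v ≡ true → u ≢ v
  adj⇒≢ {u} uv refl with () ← trans (sym uv) (irrefl H u)

  adj-sym : ∀ {u v} → adj H u v ≡ true → adj H v u ≡ true
  adj-sym {u} {v} uv = trans (symm H v u) uv

  deg<∣S∣ : ∀ S {v} → v ∈ S → deg S v < ∣ S ∣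
  deg<∣S∣ S {v} v∈S = p⊆q-x⇒∣p∣<∣q∣ (S ∩ adj H v) S v∈S λ {u} u∈ →
    let u∈S , vu = x∈p∩q⁻ S (adj H v) u∈ in x∈p∧x≢y⇒x∈p-y S u∈S (adj⇒≢ vu ∘ sym)

  deg≡𝟙+deg[S-v] : ∀ S v u → deg S u ≡ 𝟙 (S v ∧ adj H u v) + deg (S - v) u
  deg≡𝟙+deg[S-v] S v u = trans (∣p∣≡𝟙+∣p-x∣ (S ∩ adj H u) v) (cong (𝟙 (S v ∧ adj H u v) +_) (∣∣-cong commute))
    where
    commute : ∀ w → ((S ∩ adj H u) - v) w ≡ ((S - v) ∩ adj H u) w
    commute w with S w
    ... | true  = ∧-comm (adj H u w) _
    ... | false = refl

  𝟙*𝟙≡𝟙∧ : ∀ a b → 𝟙 a * 𝟙 b ≡ 𝟙 (a ∧ b)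
  𝟙*𝟙≡𝟙∧ true  b = +-identityʳ (𝟙 b)
  𝟙*𝟙≡𝟙∧ false b = refl

  degreeSum-remove : ∀ S {v} → v ∈ S → degreeSum S ≡ degreeSum (S - v) + 2 * deg S v
  degreeSum-remove S {v} v∈S = begin
    degreeSum S
      ≡⟨ sum-cong-≗ (λ u → cong (𝟙 (S u) *_) (deg≡𝟙+deg[S-v] S v u)) ⟩
    ∑[ u < N ] (𝟙 (S u) * (𝟙 (S v ∧ adj H u v) + deg S′ u))
      ≡⟨ sum-cong-≗ distrib ⟩
    ∑[ u < N ] (𝟙 (S u ∧ adj H v u) + 𝟙 (S u) * deg S′ u)
      ≡⟨ ∑-distrib-+ (λ u → 𝟙 (S u ∧ adj H v u)) (λ u → 𝟙 (S u) * deg S′ u) ⟩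
    deg S v + ∑[ u < N ] (𝟙 (S u) * deg S′ u)
      ≡⟨ cong (deg S v +_) (∑-extract v (cong (_* deg S′ v) (cong 𝟙 v∉S′)) S≗S′) ⟩
    deg S v + (𝟙 (S v) * deg S′ v + degreeSum S′)
      ≡⟨ cong (λ x → deg S v + (x + degreeSum S′)) v-term ⟩
    deg S v + (deg S v + degreeSum S′)
      ≡⟨ solve ⟩
    degreeSum S′ + 2 * deg S v
      ∎
    where
    open ≡-Reasoning
    S′ = S - v
    v∉S′ : v ∉ S′
    v∉S′ rewrite x∈⁅x⁆ v = ∧-zeroʳ (S v)
    distrib : ∀ u → 𝟙 (S u) * (𝟙 (S v ∧ adj H u v) + deg S′ u) ≡ 𝟙 (S u ∧ adj H v u) + 𝟙 (S u) * deg S′ u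
    distrib u rewrite v∈S | symm H u v =
      trans (*-distribˡ-+ (𝟙 (S u)) _ _) (cong (_+ 𝟙 (S u) * deg S′ u) (𝟙*𝟙≡𝟙∧ (S u) (adj H v u)))
    S≗S′ : ∀ u → u ≢ v → 𝟙 (S u) * deg S′ u ≡ 𝟙 (S′ u) * deg S′ u
    S≗S′ u u≢v rewrite x≢y⇒x∉⁅y⁆ u≢v | ∧-identityʳ (S u) = refl
    no-loop : (S v ∧ adj H v v) ≡ false
    no-loop = trans (cong (S v ∧_) (irrefl H v)) (∧-zeroʳ (S v))
    v-term : 𝟙 (S v) * deg S′ v ≡ deg S v
    v-term = begin
      𝟙 (S v) * deg S′ v                 ≡⟨ cong (λ b → 𝟙 b * deg S′ v) v∈S ⟩
      deg S′ v + 0                        ≡⟨ +-identityʳ _ ⟩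
      deg S′ v                            ≡⟨ cong (λ b → 𝟙 b + deg S′ v) no-loop ⟨
      𝟙 (S v ∧ adj H v v) + deg S′ v      ≡⟨ deg≡𝟙+deg[S-v] S v v ⟨
      deg S v                             ∎
    solve : deg S v + (deg S v + degreeSum S′) ≡ degreeSum S′ + 2 * deg S v
    solve = rearrange (deg S v) (degreeSum S′)
      where
      rearrange : ∀ d D → d + (d + D) ≡ D + 2 * d
      rearrange = solve-∀

  degreeSum≤ : ∀ S U c → (∀ u → 𝟙 (S u) * deg S u ≤ 𝟙 (U u) * c) → degreeSum S ≤ ∣ U ∣ * c
  degreeSum≤ S U c bound = ≤-trans (∑-mono-≤ bound) (≤-reflexive (∑[𝟙*c]≡∣p∣*c U c))

  degreeSum-remove-≤ : ∀ S v {Δ} → (∀ {u} → u ∈ S → deg S u ≤ Δ) →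
                       degreeSum S ≤ degreeSum (S - v) + 2 * Δ
  degreeSum-remove-≤ S v {Δ} deg≤Δ with S v in Sv
  ... | true  = begin
    degreeSum S                     ≡⟨ degreeSum-remove S Sv ⟩
    degreeSum (S - v) + 2 * deg S v  ≤⟨ +-monoʳ-≤ (degreeSum (S - v)) (*-monoʳ-≤ 2 (deg≤Δ Sv)) ⟩
    degreeSum (S - v) + 2 * Δ        ∎
    where open ≤-Reasoning
  ... | false = ≤-trans (≤-reflexive (degreeSum-cong S≗S-v)) (m≤m+n _ _)
    where
    S≗S-v : ∀ u → S u ≡ (S - v) u
    S≗S-v u with u ≟ v
    ... | yes refl = trans Sv (sym (∧-zeroʳ (S v)))
    ... | no  _    = sym (∧-identityʳ (S u))

  degreeSum-remove-image-≤ : ∀ {M} S (g : Fin M → Fin N) {Δ} → (∀ {u} → u ∈ S → deg S u ≤ Δ) →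
                          degreeSum S ≤ degreeSum (S ─ image ⊤ g) + M * (2 * Δ)
  degreeSum-remove-image-≤ {zero}  S g deg≤Δ =
    ≤-trans (≤-reflexive (degreeSum-cong (λ u → sym (∧-identityʳ (S u))))) (m≤m+n _ _)
  degreeSum-remove-image-≤ {suc M} S g {Δ} deg≤Δ = begin
    degreeSum S
      ≤⟨ degreeSum-remove-≤ S (g zero) deg≤Δ ⟩
    degreeSum (S - g zero) + 2 * Δ
      ≤⟨ +-monoˡ-≤ (2 * Δ) (degreeSum-remove-image-≤ (S - g zero) (g ∘ suc) deg′≤Δ) ⟩
    degreeSum (S - g zero ─ image ⊤ (g ∘ suc)) + M * (2 * Δ) + 2 * Δ
      ≡⟨ cong (λ x → x + M * (2 * Δ) + 2 * Δ) (degreeSum-cong regroup) ⟩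
    degreeSum (S ─ image ⊤ g) + M * (2 * Δ) + 2 * Δ
      ≡⟨ xy∙z≈x∙zy (degreeSum (S ─ image ⊤ g)) _ _ ⟩
    degreeSum (S ─ image ⊤ g) + suc M * (2 * Δ)
      ∎
    where
    open ≤-Reasoning
    deg′≤Δ : ∀ {u} → u ∈ S - g zero → deg (S - g zero) u ≤ Δ
    deg′≤Δ {u} u∈ = let u∈S , _ = x∈p-y⁻ S u∈ in
      ≤-trans (deg-mono (λ w∈ → proj₁ (x∈p-y⁻ S w∈)) u) (deg≤Δ u∈S)
    regroup : ∀ u → (S - g zero ─ image ⊤ (g ∘ suc)) u ≡ (S ─ image ⊤ g) u
    regroup u with S u | does (u ≟ g zero)
    ... | true  | true  = refl
    ... | true  | false = refl
    ... | false | _     = refl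

  handshake : 2 * edges H ≤ degreeSum ⊤
  handshake = begin
    2 * edges H                                     ≡⟨ cong (2 *_) edges≡∑∑ ⟩
    2 * ∑[ u < N ] ∑[ v < N ] e u v                  ≡⟨ cong (E +_) (+-identityʳ E) ⟩
    E + E                                            ≡⟨ cong (E +_) (∑-comm e) ⟩
    E + ∑[ u < N ] ∑[ v < N ] e v u                  ≡⟨ ∑-distrib-+ (λ u → ∑[ v < N ] e u v) (λ u → ∑[ v < N ] e v u) ⟨
    ∑[ u < N ] (∑[ v < N ] e u v + ∑[ v < N ] e v u) ≡⟨ sum-cong-≗ (λ u → ∑-distrib-+ (e u) (λ v → e v u)) ⟨
    ∑[ u < N ] ∑[ v < N ] (e u v + e v u)            ≤⟨ ∑-mono-≤ (λ u → ∑-mono-≤ (pair u)) ⟩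
    ∑[ u < N ] deg ⊤ u                               ≡⟨ sum-cong-≗ (λ u → +-identityʳ (deg ⊤ u)) ⟨
    degreeSum ⊤                                      ∎
    where
    open ≤-Reasoning
    e : Fin N → Fin N → ℕ
    e u v = 𝟙 ((toℕ u <ᵇ toℕ v) ∧ adj H u v)
    E = ∑[ u < N ] ∑[ v < N ] e u v
    edges≡∑∑ : edges H ≡ E
    edges≡∑∑ = trans (sum-map-allFin (λ u → sum (map (e u) (allFin N)))) (sum-cong-≗ (λ u → sum-map-allFin (e u)))
    pair : ∀ u v → e u v + e v u ≤ 𝟙 (adj H u v)
    pair u v rewrite symm H v u with toℕ u <ᵇ toℕ v in u<v | toℕ v <ᵇ toℕ u in v<u | adj H u v
    ... | true  | true  | _     = ⊥-elim (<-asym (<ᵇ⇒< (toℕ u) (toℕ v) (Equivalence.from T-≡ u<v))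
                                                (<ᵇ⇒< (toℕ v) (toℕ u) (Equivalence.from T-≡ v<u)))
    ... | true  | false | true  = ≤-refl
    ... | false | true  | true  = ≤-refl
    ... | false | false | true  = z≤n
    ... | a     | b     | false rewrite ∧-zeroʳ a | ∧-zeroʳ b = z≤n

-- Blocks and packings

module _ {N : ℕ} (H : Graph N) where

  record Block (n : ℕ) (S : Subset N) : Set where
    field
      vertex    : Fin n → Fin N
      injective : Injective _≡_ _≡_ vertex
      inside    : ∀ a → vertex a ∈ S
      neighbour : ∀ a → ∃[ b ] adj H (vertex a) (vertex b) ≡ true

  open Block

  record Packing (m n : ℕ) (S : Subset N) : Set where
    field
      block    : Fin m → Block n S
      disjoint : ∀ i j a b → vertex (block i) a ≡ vertex (block j) b → i ≡ j

  open Packing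

  Block-mono : ∀ {n S T} → S ⊆ T → Block n S → Block n T
  Block-mono S⊆T B = record
    { vertex = vertex B ; injective = injective B ; inside = S⊆T ∘ inside B ; neighbour = neighbour B }

  Packing-mono : ∀ {m n S T} → S ⊆ T → Packing m n S → Packing m n T
  Packing-mono S⊆T P = record { block = Block-mono S⊆T ∘ block P ; disjoint = disjoint P }

  empty : ∀ {n S} → Packing 0 n S
  empty = record { block = λ () ; disjoint = λ () }

  star : ∀ {k S v} → 0 < k → v ∈ S → (L : Fin k → Fin N) → Injective _≡_ _≡_ L →
         (∀ a → L a ∈ S ∩ adj H v) → Block (suc k) S
  star {k} {S} {v} 0<k v∈S L L-injective L⊆ = record
    { vertex = v ∷ L ; injective = injective′ ; inside = inside′ ; neighbour = neighbour′ }
    where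
    v-L : ∀ a → adj H v (L a) ≡ true
    v-L a = proj₂ (x∈p∩q⁻ S (adj H v) (L⊆ a))
    injective′ : Injective _≡_ _≡_ (v ∷ L)
    injective′ {zero}  {zero}  eq = refl
    injective′ {zero}  {suc b} eq = contradiction eq (adj⇒≢ H (v-L b))
    injective′ {suc a} {zero}  eq = contradiction (sym eq) (adj⇒≢ H (v-L a))
    injective′ {suc a} {suc b} eq = cong suc (L-injective eq)
    inside′ : ∀ a → (v ∷ L) a ∈ S
    inside′ zero    = v∈S
    inside′ (suc a) = proj₁ (x∈p∩q⁻ S (adj H v) (L⊆ a))
    neighbour′ : ∀ a → ∃[ b ] adj H ((v ∷ L) a) ((v ∷ L) b) ≡ true
    neighbour′ zero    = suc (fromℕ< 0<k) , v-L (fromℕ< 0<k)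
    neighbour′ (suc a) = zero , adj-sym H (v-L a)

  vertexₚ : ∀ {m n S} → Packing m n S → Fin (m * n) → Fin N
  vertexₚ {m} {n} P = uncurry (λ i a → vertex (block P i) a) ∘ remQuot {m} n

  occupied : ∀ {m n S} → Packing m n S → Subset N
  occupied P = image ⊤ (vertexₚ P)

  ∣occupied∣≤ : ∀ {m n S} (P : Packing m n S) → ∣ occupied P ∣ ≤ m * n
  ∣occupied∣≤ {m} {n} P = ≤-trans (∣image∣≤∣p∣ ⊤ (vertexₚ P)) (≤-reflexive (∣⊤∣≡n (m * n)))

  vertex∈occupied : ∀ {m n S} (P : Packing m n S) i a → vertex (block P i) a ∈ occupied P
  vertex∈occupied P i a = subst (_∈ occupied P)
    (cong (uncurry (λ i a → vertex (block P i) a)) (remQuot-combine i a))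
    (x∈p⇒f[x]∈image ⊤ (vertexₚ P) {combine i a} refl)

  occupied⊆ : ∀ {m n S} (P : Packing m n S) → occupied P ⊆ S
  occupied⊆ {m} {n} P z∈ with image⁻ ⊤ (vertexₚ P) z∈
  ... | x , _ , refl = inside (block P (proj₁ (remQuot {m} n x))) (proj₂ (remQuot {m} n x))

  cons : ∀ {m n S} (B : Block n S) (P : Packing m n S) →
         (∀ a → vertex B a ∉ occupied P) → Packing (suc m) n S
  cons {m} {n} {S} B P apart = record { block = blocks ; disjoint = disjoint′ }
    where
    blocks : Fin (suc m) → Block n S
    blocks zero    = B
    blocks (suc i) = block P i
    clash : ∀ a i b → vertex B a ≢ vertex (block P i) b
    clash a i b eq = ∈∧∉⇒≢ (occupied P) (vertex∈occupied P i b) (apart a) (sym eq)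
    disjoint′ : ∀ i j a b → vertex (blocks i) a ≡ vertex (blocks j) b → i ≡ j
    disjoint′ zero    zero    a b eq = refl
    disjoint′ zero    (suc j) a b eq = contradiction eq (clash a j b)
    disjoint′ (suc i) zero    a b eq = contradiction (sym eq) (clash b i a)
    disjoint′ (suc i) (suc j) a b eq = cong suc (disjoint P i j a b eq)

  vertex-injective : ∀ {m n S} (P : Packing m n S) →
                     ∀ i a j b → vertex (block P i) a ≡ vertex (block P j) b → i ≡ j × a ≡ b
  vertex-injective P i a j b eq with disjoint P i j a b eq
  ... | refl = refl , injective (block P i) eq

open Block
open Packing

-- Growing a block

infixl 9 _[_]≔_

_[_]≔_ : ∀ {N} → (Fin N → Fin N) → Fin N → Fin N → Fin N → Fin N
f [ u ]≔ w = updateAt f u (const w)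

[]≔-updates : ∀ {N} (f : Fin N → Fin N) u w → (f [ u ]≔ w) u ≡ w
[]≔-updates f u w = updateAt-updates u f

[]≔-minimal : ∀ {N} (f : Fin N → Fin N) {u} w {z} → z ≢ u → (f [ u ]≔ w) z ≡ f z
[]≔-minimal f {u} w {z} = updateAt-minimal z u f

module _ {N} (f : Fin N → Fin N) {x y : Fin N} (x≢y : x ≢ y) where

  swap-x : (f [ x ]≔ y [ y ]≔ x) x ≡ y
  swap-x = trans ([]≔-minimal (f [ x ]≔ y) x x≢y) ([]≔-updates f x y)

  swap-y : (f [ x ]≔ y [ y ]≔ x) y ≡ x
  swap-y = []≔-updates (f [ x ]≔ y) y x

  swap-U : ∀ (U : Subset N) → x ∉ U → y ∉ U → ∀ {z} → z ∈ U → (f [ x ]≔ y [ y ]≔ x) z ≡ f z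
  swap-U U x∉U y∉U z∈U =
    trans ([]≔-minimal (f [ x ]≔ y) x (∈∧∉⇒≢ U z∈U y∉U)) ([]≔-minimal f y (∈∧∉⇒≢ U z∈U x∉U))

module Growth {N : ℕ} (H : Graph N) (S : Subset N) where

  record Covered (U : Subset N) (f : Fin N → Fin N) : Set where
    field
      U⊆S      : U ⊆ S
      closed   : ∀ {u} → u ∈ U → f u ∈ U
      adjacent : ∀ {u} → u ∈ U → adj H u (f u) ≡ true

  open Covered

  covered-∅ : Covered ∅ (λ u → u)
  covered-∅ = record { U⊆S = λ () ; closed = λ () ; adjacent = λ () }

  covered-∪vertex : ∀ {U f u w} → Covered U f → u ∈ S ─ U → w ∈ U → adj H u w ≡ true →
                    Covered (U ∪ ⁅ u ⁆) (f [ u ]≔ w)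
  covered-∪vertex {U} {f} {u} {w} cov u∈S─U w∈U uw = record
    { U⊆S = U′⊆S ; closed = closed′ ; adjacent = adjacent′ }
    where
    u∈S = proj₁ (x∈p─q⁻ S U u∈S─U)
    u∉U = proj₂ (x∈p─q⁻ S U u∈S─U)
    U′⊆S : U ∪ ⁅ u ⁆ ⊆ S
    U′⊆S z∈ with x∈p∪⁅y⁆⁻ U z∈
    ... | inj₁ z∈U = U⊆S cov z∈U
    ... | inj₂ refl = u∈S
    closed′ : ∀ {z} → z ∈ U ∪ ⁅ u ⁆ → (f [ u ]≔ w) z ∈ U ∪ ⁅ u ⁆
    closed′ {z} z∈ with x∈p∪⁅y⁆⁻ U z∈
    ... | inj₁ z∈U rewrite []≔-minimal f w (∈∧∉⇒≢ U z∈U u∉U) =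
          p⊆p∪q U ⁅ u ⁆ (closed cov z∈U)
    ... | inj₂ refl rewrite []≔-updates f u w = p⊆p∪q U ⁅ u ⁆ w∈U
    adjacent′ : ∀ {z} → z ∈ U ∪ ⁅ u ⁆ → adj H z ((f [ u ]≔ w) z) ≡ true
    adjacent′ {z} z∈ with x∈p∪⁅y⁆⁻ U z∈
    ... | inj₁ z∈U rewrite []≔-minimal f w (∈∧∉⇒≢ U z∈U u∉U) = adjacent cov z∈U
    ... | inj₂ refl rewrite []≔-updates f u w = uw

  covered-∪edge : ∀ {U f x y} → Covered U f → x ∈ S ─ U → y ∈ S ─ U → adj H x y ≡ true →
                  Covered (U ∪ ⁅ x ⁆ ∪ ⁅ y ⁆) (f [ x ]≔ y [ y ]≔ x)
  covered-∪edge {U} {f} {x} {y} cov x∈S─U y∈S─U xy = record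
    { U⊆S = U′⊆S ; closed = closed′ ; adjacent = adjacent′ }
    where
    x∉U = proj₂ (x∈p─q⁻ S U x∈S─U)
    y∉U = proj₂ (x∈p─q⁻ S U y∈S─U)
    x≢y = adj⇒≢ H xy
    U′ = U ∪ ⁅ x ⁆ ∪ ⁅ y ⁆
    f′ = f [ x ]≔ y [ y ]≔ x
    U′⊆S : U′ ⊆ S
    U′⊆S z∈ with x∈p∪⁅y⁆∪⁅z⁆⁻ U z∈
    ... | inj₁ z∈U        = U⊆S cov z∈U
    ... | inj₂ (inj₁ refl) = proj₁ (x∈p─q⁻ S U x∈S─U)
    ... | inj₂ (inj₂ refl) = proj₁ (x∈p─q⁻ S U y∈S─U)
    closed′ : ∀ {z} → z ∈ U′ → f′ z ∈ U′
    closed′ z∈ with x∈p∪⁅y⁆∪⁅z⁆⁻ U z∈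
    ... | inj₁ z∈U        rewrite swap-U f x≢y U x∉U y∉U z∈U = p⊆p∪⁅x⁆∪⁅y⁆ U x y (closed cov z∈U)
    ... | inj₂ (inj₁ refl) rewrite swap-x f x≢y = y∈p∪⁅x⁆∪⁅y⁆ U x y
    ... | inj₂ (inj₂ refl) rewrite swap-y f x≢y = x∈p∪⁅x⁆∪⁅y⁆ U x y
    adjacent′ : ∀ {z} → z ∈ U′ → adj H z (f′ z) ≡ true
    adjacent′ z∈ with x∈p∪⁅y⁆∪⁅z⁆⁻ U z∈
    ... | inj₁ z∈U        rewrite swap-U f x≢y U x∉U y∉U z∈U = adjacent cov z∈U
    ... | inj₂ (inj₁ refl) rewrite swap-x f x≢y = xy
    ... | inj₂ (inj₂ refl) rewrite swap-y f x≢y = adj-sym H xy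

  covered-remove : ∀ {U f ρ} → Covered U f → ρ ∉ image U f → Covered (U - ρ) f
  covered-remove {U} {f} {ρ} cov ρ∉f[U] = record
    { U⊆S = U⊆S cov ∘ proj₁ ∘ x∈p-y⁻ U
    ; closed = λ z∈ → let z∈U = proj₁ (x∈p-y⁻ U z∈) in
        x∈p∧x≢y⇒x∈p-y U (closed cov z∈U) (∈∧∉⇒≢ (image U f) (x∈p⇒f[x]∈image U f z∈U) ρ∉f[U])
    ; adjacent = adjacent cov ∘ proj₁ ∘ x∈p-y⁻ U
    }

  covered⇒block : ∀ {U f} → Covered U f → Block H ∣ U ∣ S
  covered⇒block {U} {f} cov = record
    { vertex = enum U ; injective = enum-injective U ; inside = U⊆S cov ∘ enum-∈ U ; neighbour = neighbour′ }
    where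
    neighbour′ : ∀ a → ∃[ b ] adj H (enum U a) (enum U b) ≡ true
    neighbour′ a with enum-surjective U (closed cov (enum-∈ U a))
    ... | b , eq = b , subst (λ z → adj H (enum U a) z ≡ true) (sym eq) (adjacent cov (enum-∈ U a))

  NonInjective : Subset N → (Fin N → Fin N) → Set
  NonInjective U f = ∃₂ λ u₁ u₂ → u₁ ∈ U × u₂ ∈ U × u₁ ≢ u₂ × f u₁ ≡ f u₂

  Involutive : Subset N → (Fin N → Fin N) → Set
  Involutive U f = ∀ {u} → u ∈ U → f (f u) ≡ u

  nonInjective-extend : ∀ {U U′ f f′} → U ⊆ U′ → (∀ {z} → z ∈ U → f′ z ≡ f z) →
                        NonInjective U f → NonInjective U′ f′
  nonInjective-extend U⊆U′ f′≗f (u₁ , u₂ , u₁∈U , u₂∈U , u₁≢u₂ , fu₁≡fu₂) =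
    u₁ , u₂ , U⊆U′ u₁∈U , U⊆U′ u₂∈U , u₁≢u₂ , trans (f′≗f u₁∈U) (trans fu₁≡fu₂ (sym (f′≗f u₂∈U)))

  involutive⇒nonInjective-∪vertex : ∀ {U f u w} → Covered U f → Involutive U f → u ∉ U → w ∈ U →
                                     NonInjective (U ∪ ⁅ u ⁆) (f [ u ]≔ w)
  involutive⇒nonInjective-∪vertex {U} {f} {u} {w} cov invol u∉U w∈U =
    u , f w , x∈p∪⁅x⁆ U u , p⊆p∪q U ⁅ u ⁆ fw∈U , fw≢u ∘ sym ,
    trans ([]≔-updates f u w) (sym (trans ([]≔-minimal f w fw≢u) (invol w∈U)))
    where
    fw∈U = closed cov w∈U
    fw≢u = ∈∧∉⇒≢ U fw∈U u∉U

  involutive-∪edge : ∀ {U f x y} → Covered U f → Involutive U f → x ∉ U → y ∉ U → x ≢ y →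
                     Involutive (U ∪ ⁅ x ⁆ ∪ ⁅ y ⁆) (f [ x ]≔ y [ y ]≔ x)
  involutive-∪edge {U} {f} {x} {y} cov invol x∉U y∉U x≢y z∈ with x∈p∪⁅y⁆∪⁅z⁆⁻ U z∈
  ... | inj₁ z∈U rewrite swap-U f x≢y U x∉U y∉U z∈U | swap-U f x≢y U x∉U y∉U (closed cov z∈U) = invol z∈U
  ... | inj₂ (inj₁ refl) rewrite swap-x f x≢y = swap-y f x≢y
  ... | inj₂ (inj₂ refl) rewrite swap-y f x≢y = swap-x f x≢y

  data Step (U : Subset N) : Set where
    extend-vertex : ∀ {u w} → u ∈ S ─ U → w ∈ U → adj H u w ≡ true → Step U
    extend-edge   : ∀ {x y} → x ∈ S ─ U → y ∈ S ─ U → adj H x y ≡ true → Step U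
    stuck         : degreeSum H S ≤ ∣ U ∣ * (∣ U ∣ ∸ 1) → Step U

  step : ∀ U → U ⊆ S → Step U
  step U U⊆S with any? (λ u → any? (λ w → (S ─ U) u ≟ᵇ true ×-dec U w ≟ᵇ true ×-dec adj H u w ≟ᵇ true))
  ... | yes (u , w , u∈ , w∈ , uw) = extend-vertex u∈ w∈ uw
  ... | no ¬vertex with any? (λ x → any? (λ y → (S ─ U) x ≟ᵇ true ×-dec (S ─ U) y ≟ᵇ true ×-dec adj H x y ≟ᵇ true))
  ...   | yes (x , y , x∈ , y∈ , xy) = extend-edge x∈ y∈ xy
  ...   | no ¬edge = stuck (degreeSum≤ H S U (∣ U ∣ ∸ 1) bound)
    where
    bound : ∀ u → 𝟙 (S u) * deg H S u ≤ 𝟙 (U u) * (∣ U ∣ ∸ 1)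
    bound u with U u in Uu
    ... | true rewrite U⊆S Uu = +-monoˡ-≤ 0 (≤-trans (p⊆q⇒∣p∣≤∣q∣ (S ∩ adj H u) (U - u) N[u]⊆U-u)
                                                     (≤-reflexive (cong (_∸ 1) (sym (x∈p⇒∣p∣≡1+∣p-x∣ U Uu)))))
      where
      N[u]⊆U-u : S ∩ adj H u ⊆ U - u
      N[u]⊆U-u {w} w∈ with x∈p∩q⁻ S (adj H u) w∈ | ∈-or-∉ U w
      ... | _ , uw | inj₁ w∈U = x∈p∧x≢y⇒x∈p-y U w∈U (adj⇒≢ H uw ∘ sym)
      ... | w∈S , uw | inj₂ w∉U = ⊥-elim (¬vertex (w , u , x∈p∧x∉q⇒x∈p─q S U w∈S w∉U , Uu , adj-sym H uw))
    ... | false with S u in Su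
    ...   | false = z≤n
    ...   | true  = ≤-trans (≤-reflexive (+-identityʳ _))
                            (≤-trans (p⊆q⇒∣p∣≤∣q∣ (S ∩ adj H u) ∅ isolated) (≤-reflexive (∣∅∣≡0 N)))
      where
      u∈S─U = x∈p∧x∉q⇒x∈p─q S U Su Uu
      isolated : S ∩ adj H u ⊆ ∅
      isolated {w} w∈ with x∈p∩q⁻ S (adj H u) w∈ | ∈-or-∉ U w
      ... | _ , uw | inj₁ w∈U = ⊥-elim (¬vertex (u , w , u∈S─U , w∈U , uw))
      ... | w∈S , uw | inj₂ w∉U = ⊥-elim (¬edge (u , w , u∈S─U , x∈p∧x∉q⇒x∈p─q S U w∈S w∉U , uw))

  module _ (k : ℕ) where

    Flexible : Subset N → (Fin N → Fin N) → Set
    Flexible U f = NonInjective U f ⊎ (¬ (2 ∣ k) × Involutive U f × 2 ∣ (∣ U ∣))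

    flexible-∪vertex : ∀ {U f u w} → Covered U f → Flexible U f → u ∉ U → w ∈ U →
                       Flexible (U ∪ ⁅ u ⁆) (f [ u ]≔ w)
    flexible-∪vertex {U} {f} {u} {w} cov (inj₁ noninj) u∉U w∈U =
      inj₁ (nonInjective-extend (p⊆p∪q U ⁅ u ⁆) (λ z∈U → []≔-minimal f w (∈∧∉⇒≢ U z∈U u∉U)) noninj)
    flexible-∪vertex cov (inj₂ (_ , invol , _)) u∉U w∈U =
      inj₁ (involutive⇒nonInjective-∪vertex cov invol u∉U w∈U)

    flexible-∪edge : ∀ {U f x y} → Covered U f → Flexible U f → x ∉ U → y ∉ U → x ≢ y →
                     Flexible (U ∪ ⁅ x ⁆ ∪ ⁅ y ⁆) (f [ x ]≔ y [ y ]≔ x)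
    flexible-∪edge {U} {f} {x} {y} cov (inj₁ noninj) x∉U y∉U x≢y =
      inj₁ (nonInjective-extend (p⊆p∪⁅x⁆∪⁅y⁆ U x y) (swap-U f x≢y U x∉U y∉U) noninj)
    flexible-∪edge {U} cov (inj₂ (odd , invol , even)) x∉U y∉U x≢y =
      inj₂ (odd , involutive-∪edge cov invol x∉U y∉U x≢y ,
            subst (2 ∣_) (sym (x∉p∧y∉p⇒∣p∪⁅x⁆∪⁅y⁆∣≡2+∣p∣ U x∉U y∉U x≢y)) (∣m∣n⇒∣m+n n∣n even))

    module _ (dense : k * (k ∸ 1) < degreeSum H S) where

      trim : ∀ {U f x y} → Covered U f → Flexible U f → ∣ U ∣ ≡ k →
             x ∈ S ─ U → y ∈ S ─ U → adj H x y ≡ true → Block H (suc k) S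
      trim cov (inj₂ (odd , _ , even)) ∣U∣≡k _ _ _ = contradiction (subst (2 ∣_) ∣U∣≡k even) odd
      trim {U} {f} {x} {y} cov (inj₁ (_ , _ , u₁∈U , u₂∈U , u₁≢u₂ , fu₁≡fu₂)) ∣U∣≡k x∈S─U y∈S─U xy
        with pigeonhole U f u₁∈U u₂∈U u₁≢u₂ fu₁≡fu₂
      ... | ρ , ρ∈U─f[U] =
        subst (λ n → Block H n S) size
          (covered⇒block (covered-∪edge (covered-remove cov ρ∉f[U]) (shrink x∈S─U) (shrink y∈S─U) xy))
        where
        ρ∈U = proj₁ (x∈p─q⁻ U (image U f) ρ∈U─f[U])
        ρ∉f[U] = proj₂ (x∈p─q⁻ U (image U f) ρ∈U─f[U])
        shrink : ∀ {z} → z ∈ S ─ U → z ∈ S ─ (U - ρ)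
        shrink z∈ = let z∈S , z∉U = x∈p─q⁻ S U z∈ in x∈p∧x∉q⇒x∈p─q S (U - ρ) z∈S (x∉p⇒x∉p─q U ⁅ ρ ⁆ z∉U)
        size : ∣ (U - ρ) ∪ ⁅ x ⁆ ∪ ⁅ y ⁆ ∣ ≡ suc k
        size = begin
          ∣ (U - ρ) ∪ ⁅ x ⁆ ∪ ⁅ y ⁆ ∣  ≡⟨ x∉p∧y∉p⇒∣p∪⁅x⁆∪⁅y⁆∣≡2+∣p∣ (U - ρ)
                                         (proj₂ (x∈p─q⁻ S (U - ρ) (shrink x∈S─U)))
                                         (proj₂ (x∈p─q⁻ S (U - ρ) (shrink y∈S─U))) (adj⇒≢ H xy) ⟩
          suc (suc ∣ U - ρ ∣)         ≡⟨ cong suc (x∈p⇒∣p∣≡1+∣p-x∣ U ρ∈U) ⟨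
          suc ∣ U ∣                   ≡⟨ cong suc ∣U∣≡k ⟩
          suc k                       ∎
          where open ≡-Reasoning

      grow : ∀ r {U f} → Covered U f → Flexible U f → ∣ U ∣ + r ≡ suc k → Block H (suc k) S
      grow zero {U} cov flex size = subst (λ n → Block H n S) (trans (sym (+-identityʳ ∣ U ∣)) size) (covered⇒block cov)
      grow (suc r) {U} {f} cov flex size with step U (U⊆S cov)
      ... | stuck bound = contradiction (≤-trans bound (*-mono-≤ ∣U∣≤k (∸-monoˡ-≤ 1 ∣U∣≤k))) (<⇒≱ dense)
        where
        ∣U∣≤k : ∣ U ∣ ≤ k
        ∣U∣≤k = ≤-pred (≤-trans (m≤m+n (suc ∣ U ∣) r) (≤-reflexive (trans (sym (+-suc ∣ U ∣ r)) size)))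
      ... | extend-vertex {u} {w} u∈S─U w∈U uw =
        grow r (covered-∪vertex cov u∈S─U w∈U uw) (flexible-∪vertex cov flex u∉U w∈U)
          (trans (cong (_+ r) (x∉p⇒∣p∪⁅x⁆∣≡1+∣p∣ U u∉U)) (trans (sym (+-suc ∣ U ∣ r)) size))
        where u∉U = proj₂ (x∈p─q⁻ S U u∈S─U)
      ... | extend-edge x∈S─U y∈S─U xy with r
      ...   | zero = trim cov flex (suc-injective (trans (+-comm 1 ∣ U ∣) size)) x∈S─U y∈S─U xy
      ...   | suc r′ =
        grow r′ (covered-∪edge cov x∈S─U y∈S─U xy) (flexible-∪edge cov flex x∉U y∉U (adj⇒≢ H xy))
          (trans (cong (_+ r′) (x∉p∧y∉p⇒∣p∪⁅x⁆∪⁅y⁆∣≡2+∣p∣ U x∉U y∉U (adj⇒≢ H xy))) (trans (shift ∣ U ∣ r′) size))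
        where
        x∉U = proj₂ (x∈p─q⁻ S U x∈S─U)
        y∉U = proj₂ (x∈p─q⁻ S U y∈S─U)
        shift : ∀ a r → 2 + a + r ≡ a + suc (suc r)
        shift = solve-∀

  cherry : ∀ {v x y} → v ∈ S → x ∈ S ∩ adj H v → y ∈ S ∩ adj H v → x ≢ y →
           ∃₂ λ U f → Covered U f × NonInjective U f × ∣ U ∣ ≡ 3
  cherry {v} {x} {y} v∈S x∈ y∈ x≢y =
    U₁ ∪ ⁅ y ⁆ , f₁ [ y ]≔ v ,
    covered-∪vertex cov₁ (x∈p∧x∉q⇒x∈p─q S U₁ y∈S y∉U₁) v∈U₁ (adj-sym H vy) ,
    involutive⇒nonInjective-∪vertex cov₁ invol₁ y∉U₁ v∈U₁ ,
    (begin
      ∣ U₁ ∪ ⁅ y ⁆ ∣    ≡⟨ x∉p⇒∣p∪⁅x⁆∣≡1+∣p∣ U₁ y∉U₁ ⟩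
      suc ∣ U₁ ∣        ≡⟨ cong suc (x∉p∧y∉p⇒∣p∪⁅x⁆∪⁅y⁆∣≡2+∣p∣ ∅ refl refl (adj⇒≢ H vx)) ⟩
      3 + ∣ ∅ {N} ∣     ≡⟨ cong (3 +_) (∣∅∣≡0 N) ⟩
      3                 ∎)
    where
    open ≡-Reasoning
    x∈S = proj₁ (x∈p∩q⁻ S (adj H v) x∈)
    vx  = proj₂ (x∈p∩q⁻ S (adj H v) x∈)
    y∈S = proj₁ (x∈p∩q⁻ S (adj H v) y∈)
    vy  = proj₂ (x∈p∩q⁻ S (adj H v) y∈)
    U₁ = ∅ ∪ ⁅ v ⁆ ∪ ⁅ x ⁆
    f₁ = (λ u → u) [ v ]≔ x [ x ]≔ v
    cov₁ : Covered U₁ f₁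
    cov₁ = covered-∪edge covered-∅ (x∈p∧x∉q⇒x∈p─q S ∅ v∈S refl) (x∈p∧x∉q⇒x∈p─q S ∅ x∈S refl) vx
    invol₁ : Involutive U₁ f₁
    invol₁ = involutive-∪edge covered-∅ (λ ()) refl refl (adj⇒≢ H vx)
    v∈U₁ : v ∈ U₁
    v∈U₁ = x∈p∪⁅x⁆∪⁅y⁆ ∅ v x
    y∉U₁ : y ∉ U₁
    y∉U₁ with ∈-or-∉ U₁ y
    ... | inj₂ y∉U₁ = y∉U₁
    ... | inj₁ y∈U₁ with x∈p∪⁅y⁆∪⁅z⁆⁻ ∅ y∈U₁
    ...   | inj₁ ()
    ...   | inj₂ (inj₁ y≡v) = contradiction (sym y≡v) (adj⇒≢ H vy)
    ...   | inj₂ (inj₂ y≡x) = contradiction (sym y≡x) x≢y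

  dense⇒block : ∀ k → 2 ≤ k → k * (k ∸ 1) < degreeSum H S → (2 ∣ k → ∣ S ∣ < degreeSum H S) →
                Block H (suc k) S
  dense⇒block k 2≤k dense even⇒sparse with 2 ∣? k
  ... | no odd = grow k dense (suc k) covered-∅ (inj₂ (odd , (λ ()) , subst (2 ∣_) (sym (∣∅∣≡0 N)) (2 ∣0)))
                   (cong (_+ suc k) (∣∅∣≡0 N))
  ... | yes even with any? (λ v → S v ≟ᵇ true ×-dec 2 ≤? deg H S v)
  ...   | no no-branching =
    contradiction (≤-trans (degreeSum≤ H S S 1 bound) (≤-reflexive (*-identityʳ ∣ S ∣))) (<⇒≱ (even⇒sparse even))
    where
    bound : ∀ u → 𝟙 (S u) * deg H S u ≤ 𝟙 (S u) * 1
    bound u with S u in u∈S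
    ... | false = z≤n
    ... | true  with 2 ≤? deg H S u
    ...   | yes 2≤deg = contradiction (u , u∈S , 2≤deg) no-branching
    ...   | no  2≰deg = +-monoˡ-≤ 0 (≤-pred (≰⇒> 2≰deg))
  ...   | yes (v , v∈S , 2≤deg) with choose (S ∩ adj H v) 2≤deg
  ...     | g , g-injective , g⊆ with cherry v∈S (g⊆ 0F) (g⊆ 1F) (λ eq → contradiction (g-injective eq) λ ())
  ...       | U , f , cov , noninj , ∣U∣≡3 =
    grow k dense (k ∸ 2) cov (inj₁ noninj) (trans (cong (_+ (k ∸ 2)) ∣U∣≡3) (cong suc (m+[n∸m]≡n 2≤k)))

-- Packings from large degree sums

[1+n]C2≡n+nC2 : ∀ n → suc n C 2 ≡ n + n C 2
[1+n]C2≡n+nC2 n = trans (sym (nCk+nC[k+1]≡[n+1]C[k+1] n 1)) (cong (_+ n C 2) (nC1≡n n))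

open Growth using (dense⇒block)

module Packings {N : ℕ} (H : Graph N) (k R R′ t : ℕ) (2≤k : 2 ≤ k)
  (R′-large : k * (k ∸ 1) < 2 * R′)
  (R′-even : 2 ∣ k → R < 2 * R′)
  (room : ∀ j → j < t → suc k * (suc j * suc k + k ∸ 1) ≤ R + j) where

  threshold : ℕ → ℕ
  threshold j = R * j + j C 2 + R′

  threshold-suc : ∀ j → threshold (suc j) ≡ threshold j + (R + j)
  threshold-suc j = begin
    R * suc j + suc j C 2 + R′      ≡⟨ cong₂ (λ a b → a + b + R′) (*-suc R j) ([1+n]C2≡n+nC2 j) ⟩
    R + R * j + (j + j C 2) + R′    ≡⟨ regroup R (R * j) j (j C 2) R′ ⟩
    threshold j + (R + j)           ∎
    where
    open ≡-Reasoning
    regroup : ∀ r rj j c s → r + rj + (j + c) + s ≡ rj + c + s + (r + j)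
    regroup = solve-∀

  R′≤threshold : ∀ j → R′ ≤ threshold j
  R′≤threshold j = m≤n+m R′ (R * j + j C 2)

  R′-pos : 1 ≤ R′
  R′-pos = positive R′ R′-large
    where
    positive : ∀ {m} n → m < 2 * n → 1 ≤ n
    positive (suc n) _ = s≤s z≤n

  module Extend (j : ℕ) (j<t : j < t)
    (IH : ∀ S → ∣ S ∣ ≤ R + j → 2 * threshold j ≤ degreeSum H S → Packing H (suc j) (suc k) S)
    (S : Subset N) (∣S∣≤1+R+j : ∣ S ∣ ≤ suc (R + j)) (dense : 2 * threshold (suc j) ≤ degreeSum H S) where

    2*threshold-suc : 2 * threshold (suc j) ≡ 2 * threshold j + 2 * (R + j)
    2*threshold-suc = trans (cong (2 *_) (threshold-suc j)) (*-distribˡ-+ 2 (threshold j) (R + j))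

    recurse : ∀ S′ → ∣ S′ ∣ ≤ R + j → degreeSum H S ≤ degreeSum H S′ + 2 * (R + j) →
              Packing H (suc j) (suc k) S′
    recurse S′ ∣S′∣≤R+j removal = IH S′ ∣S′∣≤R+j (+-cancelʳ-≤ (2 * (R + j)) _ _ (begin
      2 * threshold j + 2 * (R + j)   ≡⟨ 2*threshold-suc ⟨
      2 * threshold (suc j)           ≤⟨ dense ⟩
      degreeSum H S                   ≤⟨ removal ⟩
      degreeSum H S′ + 2 * (R + j)    ∎))
      where open ≤-Reasoning

    high-degree : ∀ {v} → v ∈ S → suc j * suc k + k ≤ deg H S v → Packing H (suc (suc j)) (suc k) S
    high-degree {v} v∈S high =
      cons H (star H (<-≤-trans (s≤s z≤n) 2≤k) v∈S L L-injective (proj₁ ∘ x∈p─q⁻ (S ∩ adj H v) (occupied H rest) ∘ L∈free))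
             (Packing-mono H (proj₁ ∘ x∈p-y⁻ S) rest) apart
      where
      rest = recurse (S - v)
            (≤-pred (≤-trans (≤-reflexive (sym (x∈p⇒∣p∣≡1+∣p-x∣ S v∈S))) ∣S∣≤1+R+j))
            (≤-trans (≤-reflexive (degreeSum-remove H S v∈S))
                     (+-monoʳ-≤ (degreeSum H (S - v)) (*-monoʳ-≤ 2 (≤-pred (≤-trans (deg<∣S∣ H S v∈S) ∣S∣≤1+R+j)))))
      free = (S ∩ adj H v) ─ occupied H rest
      k≤∣free∣ : k ≤ ∣ free ∣
      k≤∣free∣ = +-cancelˡ-≤ (suc j * suc k) k ∣ free ∣ (begin
        suc j * suc k + k                ≤⟨ high ⟩
        ∣ S ∩ adj H v ∣                  ≤⟨ ∣p∣≤∣p─q∣+∣q∣ (S ∩ adj H v) (occupied H rest) ⟩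
        ∣ free ∣ + ∣ occupied H rest ∣   ≤⟨ +-monoʳ-≤ ∣ free ∣ (∣occupied∣≤ H rest) ⟩
        ∣ free ∣ + suc j * suc k         ≡⟨ +-comm ∣ free ∣ _ ⟩
        suc j * suc k + ∣ free ∣         ∎)
        where open ≤-Reasoning
      L = proj₁ (choose free k≤∣free∣)
      L-injective = proj₁ (proj₂ (choose free k≤∣free∣))
      L∈free = proj₂ (proj₂ (choose free k≤∣free∣))
      apart : ∀ a → (v ∷ L) a ∉ occupied H rest
      apart zero    = p⊆q∧x∉q⇒x∉p (occupied H rest) (S - v) (occupied⊆ H rest) (x∈q⇒x∉p─q S ⁅ v ⁆ (x∈⁅x⁆ v))
      apart (suc a) = proj₂ (x∈p─q⁻ (S ∩ adj H v) (occupied H rest) (L∈free a))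

    low-degree : (∀ {u} → u ∈ S → deg H S u ≤ suc j * suc k + k ∸ 1) → Packing H (suc (suc j)) (suc k) S
    low-degree low = cons H B (Packing-mono H (proj₁ ∘ x∈p─q⁻ S (image ⊤ (vertex B))) rest) apart
      where
      large : k * (k ∸ 1) < degreeSum H S
      large = <-≤-trans R′-large (≤-trans (*-monoʳ-≤ 2 (R′≤threshold (suc j))) dense)
      sparse : ∣ S ∣ < degreeSum H S
      sparse = <-≤-trans (s≤s ∣S∣≤1+R+j) (begin
        2 + (R + j)                         ≤⟨ +-mono-≤ (*-monoʳ-≤ 2 R′-pos) (m≤m+n (R + j) _) ⟩
        2 * R′ + 2 * (R + j)                ≤⟨ +-monoˡ-≤ _ (*-monoʳ-≤ 2 (R′≤threshold j)) ⟩
        2 * threshold j + 2 * (R + j)       ≡⟨ 2*threshold-suc ⟨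
        2 * threshold (suc j)               ≤⟨ dense ⟩
        degreeSum H S                       ∎)
        where open ≤-Reasoning
      B = dense⇒block H S k 2≤k large (λ _ → sparse)
      B₀∈B = x∈p⇒f[x]∈image ⊤ (vertex B) {zero} refl
      S′ = S ─ image ⊤ (vertex B)
      S′⊆S-B₀ : S′ ⊆ S - vertex B zero
      S′⊆S-B₀ z∈ = let z∈S , z∉B = x∈p─q⁻ S (image ⊤ (vertex B)) z∈ in
        x∈p∧x≢y⇒x∈p-y S z∈S (∈∧∉⇒≢ (image ⊤ (vertex B)) B₀∈B z∉B ∘ sym)
      rest = recurse S′
            (≤-pred (≤-trans (p⊆q-x⇒∣p∣<∣q∣ S′ S (inside B zero) S′⊆S-B₀) ∣S∣≤1+R+j))
            (begin
              degreeSum H S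
                ≤⟨ degreeSum-remove-image-≤ H S (vertex B) low ⟩
              degreeSum H S′ + suc k * (2 * (suc j * suc k + k ∸ 1))
                ≡⟨ cong (degreeSum H S′ +_) (x*[2*y]≡2*[x*y] (suc k) (suc j * suc k + k ∸ 1)) ⟩
              degreeSum H S′ + 2 * (suc k * (suc j * suc k + k ∸ 1))
                ≤⟨ +-monoʳ-≤ (degreeSum H S′) (*-monoʳ-≤ 2 (room j j<t)) ⟩
              degreeSum H S′ + 2 * (R + j)
                ∎)
        where
        open ≤-Reasoning
        x*[2*y]≡2*[x*y] : ∀ x y → x * (2 * y) ≡ 2 * (x * y)
        x*[2*y]≡2*[x*y] = solve-∀
      apart : ∀ a → vertex B a ∉ occupied H rest
      apart a = p⊆q∧x∉q⇒x∉p (occupied H rest) S′ (occupied⊆ H rest)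
                  (x∈q⇒x∉p─q S (image ⊤ (vertex B)) (x∈p⇒f[x]∈image ⊤ (vertex B) {a} refl))

  packing : ∀ j → j ≤ t → ∀ S → ∣ S ∣ ≤ R + j → 2 * threshold j ≤ degreeSum H S →
            Packing H (suc j) (suc k) S
  packing zero _ S ∣S∣≤R+0 dense =
    cons H (dense⇒block H S k 2≤k large even) (empty H) (λ _ → refl)
    where
    2R′≤degreeSum : 2 * R′ ≤ degreeSum H S
    2R′≤degreeSum = ≤-trans (*-monoʳ-≤ 2 (R′≤threshold 0)) dense
    large = <-≤-trans R′-large 2R′≤degreeSum
    even = λ 2∣k → <-≤-trans (≤-<-trans (≤-trans ∣S∣≤R+0 (≤-reflexive (+-identityʳ R))) (R′-even 2∣k))
                             2R′≤degreeSum
  packing (suc j) j<t S ∣S∣≤R+1+j dense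
    with any? (λ v → S v ≟ᵇ true ×-dec suc j * suc k + k ≤? deg H S v)
  ... | yes (v , v∈S , high) = Extend.high-degree j j<t IH S ∣S∣≤1+R+j dense v∈S high
    where
    IH = packing j (<⇒≤ j<t)
    ∣S∣≤1+R+j = ≤-trans ∣S∣≤R+1+j (≤-reflexive (+-suc R j))
  ... | no ¬high = Extend.low-degree j j<t IH S ∣S∣≤1+R+j dense low
    where
    IH = packing j (<⇒≤ j<t)
    ∣S∣≤1+R+j = ≤-trans ∣S∣≤R+1+j (≤-reflexive (+-suc R j))
    low : ∀ {u} → u ∈ S → deg H S u ≤ suc j * suc k + k ∸ 1
    low {u} u∈S = ≤-pred (≰⇒> (λ high → ¬high (u , u∈S , high)))

-- The parameters of the theorem

2*[m/2]≡m : ∀ m → 2 ∣ m → 2 * (m / 2) ≡ m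
2*[m/2]≡m .(q * 2) (divides-refl q) = trans (cong (2 *_) (m*n/n≡m q 2)) (*-comm 2 q)

2*nC2≡n*[n∸1] : ∀ n → 2 * (n C 2) ≡ n * (n ∸ 1)
2*nC2≡n*[n∸1] zero    = refl
2*nC2≡n*[n∸1] (suc n) = begin
  2 * (suc n C 2)        ≡⟨ cong (2 *_) ([1+n]C2≡n+nC2 n) ⟩
  2 * (n + n C 2)        ≡⟨ *-distribˡ-+ 2 n (n C 2) ⟩
  2 * n + 2 * (n C 2)    ≡⟨ cong (2 * n +_) (2*nC2≡n*[n∸1] n) ⟩
  2 * n + n * (n ∸ 1)    ≡⟨ 2n+n[n∸1]≡[1+n]n n ⟩
  suc n * n              ∎
  where
  open ≡-Reasoning
  2n+n[n∸1]≡[1+n]n : ∀ n → 2 * n + n * (n ∸ 1) ≡ suc n * n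
  2n+n[n∸1]≡[1+n]n zero    = refl
  2n+n[n∸1]≡[1+n]n (suc n) = polynomial n
    where
    polynomial : ∀ n → 2 * suc n + suc n * n ≡ suc (suc n) * suc n
    polynomial = solve-∀

2*R′ : ∀ k n → (k % 2 ≡ 0 × 2 * R′ k n ≡ k * (n ∸ 1) + 2) ⊎ (k % 2 ≢ 0 × 2 * R′ k n ≡ k * (k ∸ 1) + 2)
2*R′ k n with k % 2 in k%2
... | zero  = inj₁ (refl , trans (*-distribˡ-+ 2 (k * (n ∸ 1) / 2) 1)
                          (cong (_+ 2) (2*[m/2]≡m (k * (n ∸ 1)) (∣m⇒∣m*n (n ∸ 1) (m%n≡0⇒n∣m k 2 k%2)))))
... | suc _ = inj₂ ((λ ()) , trans (*-distribˡ-+ 2 (k C 2) 1) (cong (_+ 2) (2*nC2≡n*[n∸1] k)))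

R′-large : ∀ {k n} → k ≤ n → k * (k ∸ 1) < 2 * R′ k n
R′-large {k} {n} k≤n with 2*R′ k n
... | inj₁ (_ , eq) = subst (k * (k ∸ 1) <_) (sym eq)
                        (≤-<-trans (*-monoʳ-≤ k (∸-monoˡ-≤ 1 k≤n)) (m<m+n (k * (n ∸ 1)) (s≤s z≤n)))
... | inj₂ (_ , eq) = subst (k * (k ∸ 1) <_) (sym eq) (m<m+n (k * (k ∸ 1)) (s≤s z≤n))

R′-even : ∀ {k n} → 2 ∣ k → k * (n ∸ 1) + 1 < 2 * R′ k n
R′-even {k} {n} 2∣k with 2*R′ k n
... | inj₁ (_ , eq)   = subst (k * (n ∸ 1) + 1 <_) (sym eq) (+-monoʳ-< (k * (n ∸ 1)) ≤-refl)
... | inj₂ (odd , _) = contradiction (n∣m⇒m%n≡0 k 2 2∣k) odd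

room : ∀ {k n t} → 2 ≤ k → 3 * k + 3 ≤ n → t ≤ (k * n ∸ 2 * k * k) / (suc k * suc k) →
       ∀ j → j < t → suc k * (suc j * suc k + k ∸ 1) ≤ k * (n ∸ 1) + 1 + j
room {n = zero} (s≤s (s≤s z≤n)) ()
room {k@(suc (suc k′))} {n@(suc n′)} (s≤s (s≤s z≤n)) 3k+3≤n t≤bound j j<t = begin
  suc k * (suc j * suc k + k ∸ 1)                ≡⟨ cong (suc k *_) (+-∸-assoc (suc j * suc k) {k} {1} (s≤s z≤n)) ⟩
  suc k * (suc j * suc k + suc k′)               ≡⟨ distrib (suc j) (suc k) (suc k′) ⟩
  suc j * (suc k * suc k) + suc k * suc k′       ≤⟨ +-monoˡ-≤ _ (≤-trans (*-monoˡ-≤ (suc k * suc k) (≤-trans j<t t≤bound))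
                                                                         (m/n*n≤m X (suc k * suc k))) ⟩
  X + suc k * suc k′                             ≤⟨ +-cancelʳ-≤ (2 * k * k) _ _ (begin
    X + suc k * suc k′ + 2 * k * k                   ≡⟨ xy∙z≈xz∙y X _ _ ⟩
    X + 2 * k * k + suc k * suc k′                   ≡⟨ cong (_+ suc k * suc k′) (m∸n+n≡m 2kk≤kn) ⟩
    k * n + suc k * suc k′                           ≤⟨ m≤m+n _ (k′ * k′ + 3 * k′ + 4) ⟩
    k * n + suc k * suc k′ + (k′ * k′ + 3 * k′ + 4)  ≡⟨ slack k′ n′ ⟩
    k * n′ + 1 + 2 * k * k                           ∎) ⟩
  k * n′ + 1                                     ≤⟨ m≤m+n _ j ⟩
  k * n′ + 1 + j                                 ∎
  where
  open ≤-Reasoning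
  X = k * n ∸ 2 * k * k
  2kk≤kn : 2 * k * k ≤ k * n
  2kk≤kn = ≤-trans (≤-reflexive (*-comm (2 * k) k))
                   (*-monoʳ-≤ k (≤-trans (*-monoˡ-≤ k (s≤s (s≤s (z≤n {1})))) (≤-trans (m≤m+n (3 * k) 3) 3k+3≤n)))
  distrib : ∀ a b c → b * (a * b + c) ≡ a * (b * b) + b * c
  distrib = solve-∀
  slack : ∀ k′ n′ → (2 + k′) * (1 + n′) + (3 + k′) * (1 + k′) + (k′ * k′ + 3 * k′ + 4)
                  ≡ (2 + k′) * n′ + 1 + 2 * (2 + k′) * (2 + k′)
  slack = solve-∀

lemma3 : (k n t : ℕ) → 2 ≤ k → 3 * k + 3 ≤ n →
    t ≤ (k * n ∸ 2 * k * k) / (suc k * suc k) →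
    (H : Graph ((k * (n ∸ 1) + 1) + t)) →
    (k * (n ∸ 1) + 1) * t + t C 2 + R′ k n ≤ edges H →
    Σ (Fin (suc t) → Fin (suc k) → Fin ((k * (n ∸ 1) + 1) + t)) λ A →
      ((∀ i a j b → A i a ≡ A j b → (i ≡ j × a ≡ b))
      × (∀ (i : Fin (suc t)) (a : Fin (suc k)) → ∃[ b ] (adj H (A i a) (A i b) ≡ true)))
lemma3 k n t 2≤k 3k+3≤n t≤bound H many-edges =
  (λ i → vertex (block packed i)) , vertex-injective H packed , (λ i → neighbour (block packed i))
  where
  R = k * (n ∸ 1) + 1
  k≤n : k ≤ n
  k≤n = ≤-trans (≤-trans (m≤n*m k 3) (m≤m+n (3 * k) 3)) 3k+3≤n
  open Packings H k R (R′ k n) t 2≤k (R′-large k≤n) R′-even (room 2≤k 3k+3≤n t≤bound)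
  packed = packing t ≤-refl ⊤ (≤-reflexive (∣⊤∣≡n (R + t))) (≤-trans (*-monoʳ-≤ 2 many-edges) (handshake H))
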